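{- Let $\mathcal{F}\subseteq\mathcal{P}(X)$ and $X_0\subseteq X$. Then every subfamily $\mathcal{F}_0$ of $\mathcal{F}\restriction X_0=\{X_0\cap S: S\in\mathcal{F}\}$ satisfies $\mathrm{VC}(\mathcal{F}_0)\leq\mathrm{VC}(\mathcal{F})$. In particular, for cardinals $\lambda\leq\theta\leq\kappa$ and $\lambda_0\leq\theta_0\leq\kappa_0$ with $\kappa_0\leq\kappa$, $\lambda_0\leq\lambda$ and $\theta\leq\theta_0$, we have $\mathrm{VCcof}(\lambda_0,\theta_0,\kappa_0)\leq\mathrm{VCcof}(\lambda,\theta,\kappa)$.
   Context: $[X]^{<\theta}$ is the set of subsets of $X$ of cardinality $<\theta$. A family $\mathcal{F}\subseteq[X]^{<\theta}$ is $\lambda$-cofinal if every $A\in[X]^{<\lambda}$ is contained in a member of $\mathcal{F}$. A set $A$ is shattered by $\mathcal{F}$ if for every $A_0\subseteq A$ there is $S\in\mathcal{F}$ with $A_0=A\cap S$; $\mathrm{VC}(\mathcal{F})$ is the maximal size of a finite shattered set, or $\infty$ if unbounded. $\mathrm{VCcof}(\lambda,\theta,\kappa)$ is the least $n\in\omega\cup\{\infty\}$ such that some $\lambda$-cofinal $\mathcal{F}\subseteq[\kappa]^{<\theta}$ has $\mathrm{VC}(\mathcal{F})=n$. -}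

module Defs where

open import Level using (Level; suc; zero)
open import Data.Nat using (ℕ)
open import Data.Fin using (Fin)
open import Data.Bool using (Bool; true)
open import Data.Product using (Σ; Σ-syntax; _×_)
open import Relation.Nullary using (¬_)
open import Relation.Binary.PropositionalEquality using (_≡_)
open import Function.Definitions using (Injective)
open import Function.Bundles using (_⇔_)

Subset : Set → Set₁
Subset X = X → Set

Family : Set → Set₂
Family X = Subset X → Set₁

_⊆_ : {X : Set} → Subset X → Subset X → Set
A ⊆ B = ∀ x → A x → B x

_⊆F_ : {X : Set} → Family X → Family X → Set₁
F₀ ⊆F F = ∀ S → F₀ S → F S

_↾_ : {X : Set} → Family X → Subset X → Family X
(F ↾ X₀) T = Σ[ S ∈ Subset _ ] (F S × (∀ x → T x ⇔ (X₀ x × S x)))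

-- Cardinals are modelled as types; |T| ≤ |U| means an injection T → U.

_≼_ : Set → Set → Set
T ≼ U = Σ[ f ∈ (T → U) ] Injective _≡_ _≡_ f

InjInto : {X : Set} → Subset X → Set → Set
InjInto {X} A T =
  Σ[ f ∈ ((x : X) → A x → T) ] (∀ x y (a : A x) (b : A y) → f x a ≡ f y b → x ≡ y)

Embeds : {X : Set} → Set → Subset X → Set
Embeds {X} T A = Σ[ g ∈ (T → X) ] ((∀ t → A (g t)) × Injective _≡_ _≡_ g)

Card< : {X : Set} → Subset X → Set → Set
Card< A θ = InjInto A θ × ¬ Embeds θ A

Bounded : {κ : Set} → Family κ → Set → Set₁
Bounded {κ} F θ = ∀ (S : Subset κ) → F S → Card< S θ

Cofinal : {κ : Set} → Set → Family κ → Set₁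
Cofinal {κ} l F = ∀ (A : Subset κ) → Card< A l → Σ[ S ∈ Subset κ ] (F S × A ⊆ S)

Shattered : {X : Set} → Family X → {n : ℕ} → (Fin n → X) → Set₁
Shattered {X} F {n} a =
  ∀ (A₀ : Fin n → Bool) → Σ[ S ∈ Subset X ] (F S × (∀ i → S (a i) ⇔ (A₀ i ≡ true)))

Shatters : {X : Set} → Family X → ℕ → Set₁
Shatters {X} F n = Σ[ a ∈ (Fin n → X) ] (Injective _≡_ _≡_ a × Shattered F a)

-- VC(ℱ₀) ≤ VC(𝒢) in ω ∪ {∞}: since VC is the supremum of the sizes of
-- shattered finite sets (and shattering is closed downwards), this says
-- every size shattered by ℱ₀ is shattered by 𝒢.
VC≤ : {X Y : Set} → Family X → Family Y → Set₁
VC≤ F₀ G = ∀ (n : ℕ) → Shatters F₀ n → Shatters G n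

-- VCcof(λ₀,θ₀,κ₀) ≤ VCcof(λ,θ,κ): for every λ-cofinal ℱ ⊆ [κ]^{<θ} there is
-- a λ₀-cofinal ℱ₀ ⊆ [κ₀]^{<θ₀} with VC(ℱ₀) ≤ VC(ℱ).
-- (Classically equivalent to the inequality between the minima.)
VCcof≤ : (l₀ t₀ k₀ l t k : Set) → Set₂
VCcof≤ l₀ t₀ k₀ l t k =
  ∀ (F : Family k) → Bounded F t → Cofinal l F →
    Σ[ F₀ ∈ Family k₀ ] (Bounded F₀ t₀ × Cofinal l₀ F₀ × VC≤ F₀ F)

module Submission where

open import Defs
open import Data.Bool using (true)
open import Data.Fin using (Fin)
open import Data.Product using (_×_; _,_; proj₁; proj₂; Σ-syntax)
open import Function using (_∘_)
open import Function.Bundles using (_⇔_; mk⇔; Equivalence)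
open import Function.Definitions using (Injective)
open import Relation.Binary.PropositionalEquality using (_≡_; refl; cong)

open Equivalence

private
  variable
    X Y θ θ′ : Set

-- A set shattered by ℱ₀ ⊆ ℱ ↾ X₀ lies inside X₀ (its full subset is cut out
-- by some X₀ ∩ S), and on X₀ the trace X₀ ∩ S is indistinguishable from S.
Shattered-restriction : {F F₀ : Family X} {X₀ : Subset X} → F₀ ⊆F (F ↾ X₀) →
                        ∀ {n} {a : Fin n → X} → Shattered F₀ a → Shattered F a
Shattered-restriction {X₀ = X₀} F₀⊆F↾X₀ {a = a} shattered A₀
  with shattered A₀
... | T , F₀T , T∋a⇔A₀ with F₀⊆F↾X₀ T F₀T
... | S , FS , T⇔X₀∩S =
  S , FS , λ i → mk⇔ (λ Sa → to (T∋a⇔A₀ i) (from (T⇔X₀∩S (a i)) (a∈X₀ i , Sa)))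
                     (λ A₀i → proj₂ (to (T⇔X₀∩S (a i)) (from (T∋a⇔A₀ i) A₀i)))
  where
  a∈X₀ : ∀ i → X₀ (a i)
  a∈X₀ i with shattered (λ _ → true)
  ... | U , F₀U , U∋a⇔true with F₀⊆F↾X₀ U F₀U
  ... | _ , _ , U⇔X₀∩S′ = proj₁ (to (U⇔X₀∩S′ (a i)) (from (U∋a⇔true i) refl))

VC≤-restriction : {F F₀ : Family X} {X₀ : Subset X} → F₀ ⊆F (F ↾ X₀) → VC≤ F₀ F
VC≤-restriction F₀⊆F↾X₀ n (a , a-inj , shattered) =
  a , a-inj , Shattered-restriction F₀⊆F↾X₀ shattered

InjInto-mono : {A : Subset X} → θ ≼ θ′ → InjInto A θ → InjInto A θ′
InjInto-mono (h , h-inj) (f , f-inj) =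
  (λ x a → h (f x a)) , (λ x y a b eq → f-inj x y a b (h-inj eq))

Embeds-antimono : {A : Subset X} → θ ≼ θ′ → Embeds θ′ A → Embeds θ A
Embeds-antimono (h , h-inj) (g , g∈A , g-inj) = g ∘ h , (λ u → g∈A (h u)) , h-inj ∘ g-inj

Card<-mono : {A : Subset X} → θ ≼ θ′ → Card< A θ → Card< A θ′
Card<-mono {A = A} θ≼θ′ (A↪θ , θ↪̸A) =
  InjInto-mono {A = A} θ≼θ′ A↪θ ,
  λ θ′↪A → θ↪̸A (Embeds-antimono {A = A} θ≼θ′ θ′↪A)

Card<-preimage : {e : Y → X} → Injective _≡_ _≡_ e → {S : Subset X} →
                 Card< S θ → Card< (S ∘ e) θ
Card<-preimage {e = e} e-inj ((f , f-inj) , θ↪̸S) =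
  ((λ y s → f (e y) s) , (λ y y′ s s′ eq → e-inj (f-inj (e y) (e y′) s s′ eq))) ,
  λ { (g , g∈S∘e , g-inj) → θ↪̸S (e ∘ g , g∈S∘e , g-inj ∘ e-inj) }

image : (Y → X) → Subset Y → Subset X
image e A x = Σ[ y ∈ _ ] (A y × e y ≡ x)

Card<-image : {e : Y → X} → Injective _≡_ _≡_ e → {A : Subset Y} →
              Card< A θ → Card< (image e A) θ
Card<-image {e = e} e-inj {A} ((f , f-inj) , θ↪̸A) = (f′ , f′-inj) , θ↪̸A ∘ pull
  where
  f′ : ∀ x → image e A x → _
  f′ _ (y , a , _) = f y a

  f′-inj : ∀ x x′ a a′ → f′ x a ≡ f′ x′ a′ → x ≡ x′
  f′-inj _ _ (y , a , refl) (y′ , a′ , refl) eq = cong e (f-inj y y′ a a′ eq)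

  pull : Embeds _ (image e A) → Embeds _ A
  pull (g , g∈eA , g-inj) =
    (proj₁ ∘ g∈eA) , (proj₁ ∘ proj₂ ∘ g∈eA) ,
    λ {u} {u′} eq → g-inj (witness-determines-point (g∈eA u) (g∈eA u′) eq)
    where
    witness-determines-point : ∀ {x x′} (p : image e A x) (p′ : image e A x′) →
                               proj₁ p ≡ proj₁ p′ → x ≡ x′
    witness-determines-point (_ , _ , refl) (_ , _ , refl) refl = refl

pullback : (Y → X) → Family X → Family Y
pullback e F T = Σ[ S ∈ Subset _ ] (F S × T ≡ S ∘ e)

Bounded-mono : {F : Family X} → θ ≼ θ′ → Bounded F θ → Bounded F θ′
Bounded-mono θ≼θ′ bounded S FS = Card<-mono θ≼θ′ (bounded S FS)

Cofinal-antimono : {F : Family X} → θ ≼ θ′ → Cofinal θ′ F → Cofinal θ F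
Cofinal-antimono θ≼θ′ cofinal A |A|<θ = cofinal A (Card<-mono θ≼θ′ |A|<θ)

Bounded-pullback : {e : Y → X} → Injective _≡_ _≡_ e → {F : Family X} →
                   Bounded F θ → Bounded (pullback e F) θ
Bounded-pullback e-inj bounded _ (S , FS , refl) = Card<-preimage e-inj (bounded S FS)

Cofinal-pullback : {e : Y → X} → Injective _≡_ _≡_ e → {F : Family X} →
                   Cofinal θ F → Cofinal θ (pullback e F)
Cofinal-pullback {e = e} e-inj cofinal A |A|<θ
  with cofinal (image e A) (Card<-image e-inj |A|<θ)
... | S , FS , eA⊆S = S ∘ e , (S , FS , refl) , λ y Ay → eA⊆S (e y) (y , Ay , refl)

VC≤-pullback : {e : Y → X} → Injective _≡_ _≡_ e → {F : Family X} →
               VC≤ (pullback e F) F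
VC≤-pullback {e = e} e-inj {F} n (a , a-inj , shattered) =
  e ∘ a , a-inj ∘ e-inj , λ A₀ → trace A₀ (shattered A₀)
  where
  trace : ∀ A₀ → Σ[ T ∈ _ ] (pullback e F T × (∀ i → T (a i) ⇔ (A₀ i ≡ true))) →
          Σ[ S ∈ _ ] (F S × (∀ i → S (e (a i)) ⇔ (A₀ i ≡ true)))
  trace _ (_ , (S , FS , refl) , T∋a⇔A₀) = S , FS , T∋a⇔A₀

-- The conditions λ ≤ θ ≤ κ and λ₀ ≤ θ₀ ≤ κ₀ only say that both sides are
-- meaningful; the comparison itself uses just κ₀ ≤ κ, λ₀ ≤ λ and θ ≤ θ₀:
-- ℱ₀ is the pullback of ℱ along the embedding κ₀ ↪ κ.
VCcof≤-mono : {l t k l₀ t₀ k₀ : Set} →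
              k₀ ≼ k → l₀ ≼ l → t ≼ t₀ → VCcof≤ l₀ t₀ k₀ l t k
VCcof≤-mono (e , e-inj) l₀≼l t≼t₀ F bounded cofinal =
  pullback e F ,
  Bounded-mono t≼t₀ (Bounded-pullback e-inj bounded) ,
  Cofinal-antimono l₀≼l (Cofinal-pullback e-inj cofinal) ,
  VC≤-pullback e-inj

proposition2p4 :
  (∀ (X : Set) (F : Family X) (X₀ : Subset X) (F₀ : Family X) →
     F₀ ⊆F (F ↾ X₀) → VC≤ F₀ F)
  ×
  (∀ (l t k l₀ t₀ k₀ : Set) →
     l ≼ t → t ≼ k → l₀ ≼ t₀ → t₀ ≼ k₀ →
     k₀ ≼ k → l₀ ≼ l → t ≼ t₀ →
     VCcof≤ l₀ t₀ k₀ l t k)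
proposition2p4 =
  (λ _ _ _ _ → VC≤-restriction) ,
  (λ _ _ _ _ _ _ _ _ _ _ → VCcof≤-mono)
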